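{- For every integer $q\ge 2$, the $(2q+1)$-colouring $\psi$ of $D_q$ is Kempe frozen.
   Context: For an integer $q\ge2$, let $\overline{D_q}$ be the graph on the $4q+2$ vertices $u_0,u_1,\dots,u_{q+1}$ and $v_{i1},v_{i2},v_{i3}$ ($i=1,\dots,q$) whose edges are: the edges of the Hamiltonian cycle $u_0,u_1,\dots,u_{q+1},v_{11},v_{12},v_{13},v_{21},v_{22},v_{23},\dots,v_{q1},v_{q2},v_{q3},u_0$; the edges $u_iv_{i2}$ for $i=1,\dots,q$; and the edges $v_{i1}v_{i3}$ for $i=1,\dots,q$. Let $D_q$ be the complement of $\overline{D_q}$ (same vertex set; two distinct vertices adjacent in $D_q$ iff nonadjacent in $\overline{D_q}$). Let $\psi$ be the $(2q+1)$-colouring of $D_q$ whose colour classes are $\{u_i,v_{i2}\}$ for $i=1,\dots,q$, $\{u_{q+1},v_{11}\}$, $\{v_{i3},v_{i+1,1}\}$ for $i=1,\dots,q-1$, and $\{v_{q3},u_0\}$. A $k$-colouring (proper colouring with colours $1,\dots,k$) is Kempe frozen if each of the $k$ colours is used on some vertex and for any two colours the subgraph induced by the union of the two corresponding colour classes is connected. -}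

module Defs where

open import Data.Nat using (ℕ; zero; suc; _+_; _*_; _∸_; _≤ᵇ_)
open import Data.Fin using (Fin; toℕ)
open import Data.Bool using (if_then_else_)
open import Data.Product using (_×_; ∃)
open import Data.Sum using (_⊎_)
open import Relation.Binary.PropositionalEquality using (_≡_; _≢_)
open import Relation.Nullary using (¬_)

data InducedWalk {V : Set} (Adj : V → V → Set) (P : V → Set) : V → V → Set where
  here : ∀ {x} → P x → InducedWalk Adj P x x
  step : ∀ {x y z} → P x → Adj x y → InducedWalk Adj P y z → InducedWalk Adj P x z

InducedConnected : {V : Set} → (V → V → Set) → (V → Set) → Set
InducedConnected {V} Adj P = ∀ (x y : V) → P x → P y → InducedWalk Adj P x y

-- c is a proper k-colouring (colours are Fin k, i.e. 1..k shifted to 0..k-1).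
ProperColouring : {V : Set} → (V → V → Set) → (k : ℕ) → (V → Fin k) → Set
ProperColouring {V} Adj k c = ∀ (x y : V) → Adj x y → c x ≢ c y

KempeFrozen : {V : Set} → (V → V → Set) → (k : ℕ) → (V → Fin k) → Set
KempeFrozen {V} Adj k c =
  (∀ (a : Fin k) → ∃ λ (x : V) → c x ≡ a) ×
  (∀ (a b : Fin k) → a ≢ b →
     InducedConnected Adj (λ x → (c x ≡ a) ⊎ (c x ≡ b)))

-- Vertices: u i  stands for u_i  (i = 0..q+1),
--           v i j stands for v_{(i+1),(j+1)}  (i = 0..q-1, j = 0..2).
data Vtx (q : ℕ) : Set where
  u : Fin (suc (suc q)) → Vtx q
  v : Fin q → Fin 3 → Vtx q

-- Position of a vertex on the Hamiltonian cycle
-- u_0, ..., u_{q+1}, v_11, v_12, v_13, ..., v_q1, v_q2, v_q3 (then back to u_0).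
pos : (q : ℕ) → Vtx q → ℕ
pos q (u i)   = toℕ i
pos q (v i j) = suc (suc q) + 3 * toℕ i + toℕ j

data D̄Arc (q : ℕ) : Vtx q → Vtx q → Set where
  cyc   : ∀ {x y} → suc (pos q x) ≡ pos q y → D̄Arc q x y
  -- closing edge v_q3 u_0  (position 4q+1 to position 0)
  close : ∀ {x y} → pos q x ≡ 4 * q + 1 → pos q y ≡ 0 → D̄Arc q x y
  -- u_i v_{i2}, i = 1..q
  uv    : ∀ (i : Fin (suc (suc q))) (k : Fin q) → toℕ i ≡ suc (toℕ k) →
          D̄Arc q (u i) (v k (Fin.suc Fin.zero))
  -- v_{i1} v_{i3}, i = 1..q
  vv    : ∀ (k : Fin q) → D̄Arc q (v k Fin.zero) (v k (Fin.suc (Fin.suc Fin.zero)))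

D̄Adj : (q : ℕ) → Vtx q → Vtx q → Set
D̄Adj q x y = D̄Arc q x y ⊎ D̄Arc q y x

DAdj : (q : ℕ) → Vtx q → Vtx q → Set
DAdj q x y = (x ≢ y) × ¬ D̄Adj q x y

-- Colour numbers:
--   {u_i, v_{i2}}          ↦ i - 1       (i = 1..q)
--   {u_{q+1}, v_{11}}      ↦ q
--   {v_{i3}, v_{i+1,1}}    ↦ q + i       (i = 1..q-1)
--   {v_{q3}, u_0}          ↦ 2q
ψℕ : (q : ℕ) → Vtx q → ℕ
ψℕ q (u i) with toℕ i
... | zero  = 2 * q
... | suc m = if suc m ≤ᵇ q then m else q
ψℕ q (v k j) with toℕ j
... | 0 = if toℕ k ≤ᵇ 0 then q else q + toℕ k
... | 1 = toℕ k
... | _ = q + suc (toℕ k)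

-- Convert to Fin (suc n), clamping (ψℕ never exceeds 2q, so this is exact).
clamp : (n : ℕ) → ℕ → Fin (suc n)
clamp zero    _       = Fin.zero
clamp (suc n) zero    = Fin.zero
clamp (suc n) (suc m) = Fin.suc (clamp n m)

ψ : (q : ℕ) → Vtx q → Fin (suc (2 * q))
ψ q x = clamp (2 * q) (ψℕ q x)

module Submission where

-- Every colour class of ψ is a pair of vertices adjacent in D̄_q, so ψ is proper on D_q.
-- Between two colour classes D̄_q has at most one edge, because the two vertices of a
-- class see disjoint sets of colours on their other D̄_q-neighbours (this is where q ≥ 2
-- is used).  Hence the union of two classes induces in D_q the complete bipartite graph
-- K_{2,2} minus at most one edge, which is connected.

open import Defs
open import Data.Bool using (Bool; true; false; not; T; if_then_else_)
open import Data.Empty using (⊥-elim)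
open import Data.Fin using (Fin; toℕ) renaming (suc to fs)
open import Data.Fin.Patterns using (0F; 1F; 2F)
open import Data.Fin.Properties using (toℕ-injective; toℕ<n) renaming (_≟_ to _≟ᶠ_)
open import Data.Nat using (ℕ; zero; suc; pred; _+_; _*_; _∸_; _≤_; _<_; _≤ᵇ_; z≤n; s≤s; z<s; s≤s⁻¹; NonZero)
open import Data.Nat.Divisibility using (m∣m*n)
open import Data.Nat.DivMod using (_%_; %-remove-+ˡ; m<n⇒m%n≡m)
open import Data.Nat.Properties
open import Data.Nat.Tactic.RingSolver using (solve-∀)
open import Data.Product using (_×_; _,_; ∃)
open import Data.Sum using (_⊎_; inj₁; inj₂; swap; map₁; map₂)
open import Data.Unit using (tt)
open import Function using (_∘_; flip)
open import Relation.Binary.Definitions using (Symmetric; Decidable; tri<; tri≈; tri>)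
open import Relation.Binary.PropositionalEquality
open import Relation.Nullary using (¬_; Dec; yes; no; contradiction)
open import Relation.Nullary.Decidable using (_⊎-dec_; _×-dec_; map′)

module _ {V : Set} {Adj : V → V → Set} {P : V → Set} where

  walk-start : ∀ {x y} → InducedWalk Adj P x y → P x
  walk-start (here px)     = px
  walk-start (step px _ _) = px

  _++ʷ_ : ∀ {x y z} → InducedWalk Adj P x y → InducedWalk Adj P y z → InducedWalk Adj P x z
  here _      ++ʷ w′ = w′
  step px e w ++ʷ w′ = step px e (w ++ʷ w′)

  walk-reverse : Symmetric Adj → ∀ {x y} → InducedWalk Adj P x y → InducedWalk Adj P y x
  walk-reverse adj-sym (here px)     = here px
  walk-reverse adj-sym (step px e w) =
    walk-reverse adj-sym w ++ʷ step (walk-start w) (adj-sym e) (here px)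

divMod-unique : ∀ n .{{_ : NonZero n}} k k′ {j j′} → j < n → j′ < n →
                n * k + j ≡ n * k′ + j′ → k ≡ k′ × j ≡ j′
divMod-unique n k k′ {j} {j′} j<n j′<n e = quotients , remainders
  where
  open ≡-Reasoning
  remainders : j ≡ j′
  remainders = begin
    j                 ≡⟨ m<n⇒m%n≡m j<n ⟨
    j % n             ≡⟨ %-remove-+ˡ j (m∣m*n k) ⟨
    (n * k + j) % n   ≡⟨ cong (_% n) e ⟩
    (n * k′ + j′) % n ≡⟨ %-remove-+ˡ j′ (m∣m*n k′) ⟩
    j′ % n            ≡⟨ m<n⇒m%n≡m j′<n ⟩
    j′                ∎
  quotients : k ≡ k′
  quotients = *-cancelˡ-≡ k k′ n (+-cancelʳ-≡ j (n * k) (n * k′)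
                (trans e (cong (n * k′ +_) (sym remainders))))

toℕ-clamp : ∀ n m → m ≤ n → toℕ (clamp n m) ≡ m
toℕ-clamp zero    zero    z≤n      = refl
toℕ-clamp (suc n) zero    _        = refl
toℕ-clamp (suc n) (suc m) (s≤s m≤n) = cong suc (toℕ-clamp n m m≤n)

clamp-toℕ : ∀ n (i : Fin (suc n)) → clamp n (toℕ i) ≡ i
clamp-toℕ zero    0F     = refl
clamp-toℕ (suc n) 0F     = refl
clamp-toℕ (suc n) (fs i) = cong fs (clamp-toℕ n i)

disjoint-pairs : ∀ {A : Set} {x a₁ a₂ b₁ b₂ : A} → a₁ ≢ b₁ → a₁ ≢ b₂ → a₂ ≢ b₁ → a₂ ≢ b₂ →
        x ≡ a₁ ⊎ x ≡ a₂ → ¬ (x ≡ b₁ ⊎ x ≡ b₂)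
disjoint-pairs a₁≢b₁ _ _ _ (inj₁ refl) (inj₁ e) = a₁≢b₁ e
disjoint-pairs _ a₁≢b₂ _ _ (inj₁ refl) (inj₂ e) = a₁≢b₂ e
disjoint-pairs _ _ a₂≢b₁ _ (inj₂ refl) (inj₁ e) = a₂≢b₁ e
disjoint-pairs _ _ _ a₂≢b₂ (inj₂ refl) (inj₂ e) = a₂≢b₂ e

module PairedComplement
  {V : Set} (H : V → V → Set) (H-sym : Symmetric H) (H? : Decidable H)
  {k : ℕ} (c : V → Fin k) (member : Fin k → Bool → V)
  (c-member : ∀ a s → c (member a s) ≡ a)
  (member-cover : ∀ x → ∃ λ s → member (c x) s ≡ x)
  (member-linked : ∀ a → H (member a true) (member a false))
  (member-distinct : ∀ a → member a true ≢ member a false)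
  (one-edge-between : ∀ {s t s′ t′} → c s ≢ c t → c s ≡ c s′ → c t ≡ c t′ → H s t → H s′ t′ → s ≡ s′)
  where

  Complement : V → V → Set
  Complement x y = x ≢ y × ¬ H x y

  complement-sym : Symmetric Complement
  complement-sym (x≢y , ¬h) = x≢y ∘ sym , ¬h ∘ H-sym

  covered : ∀ {a x} → c x ≡ a → ∃ λ s → member a s ≡ x
  covered refl = member-cover _

  same-class : ∀ a s s′ → c (member a s) ≡ c (member a s′)
  same-class a s s′ = trans (c-member a s) (sym (c-member a s′))

  members-distinct : ∀ a s → member a s ≢ member a (not s)
  members-distinct a true  = member-distinct a
  members-distinct a false = member-distinct a ∘ sym

  members-linked : ∀ a s t → member a s ≢ member a t → H (member a s) (member a t)
  members-linked a true  true  ne = contradiction refl ne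
  members-linked a true  false _  = member-linked a
  members-linked a false true  _  = H-sym (member-linked a)
  members-linked a false false ne = contradiction refl ne

  same-colour-linked : ∀ {a x y} → c x ≡ a → c y ≡ a → x ≢ y → H x y
  same-colour-linked ex ey x≢y with covered ex | covered ey
  ... | s , refl | t , refl = members-linked _ s t x≢y

  proper : ProperColouring Complement k c
  proper x y (x≢y , ¬h) e = ¬h (same-colour-linked e refl x≢y)

  module TwoColours {a b : Fin k} (a≢b : a ≢ b) where

    P : V → Set
    P z = c z ≡ a ⊎ c z ≡ b

    Walk : V → V → Set
    Walk = InducedWalk Complement P

    colours-differ : ∀ s t → c (member a s) ≢ c (member b t)
    colours-differ s t e = a≢b (trans (sym (c-member a s)) (trans e (c-member b t)))

    across : ∀ s t → ¬ H (member a s) (member b t) → Complement (member a s) (member b t)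
    across s t ¬h = colours-differ s t ∘ cong c , ¬h

    -- If member a s and member b t are linked in H, no other H-edge joins the two classes,
    -- leaving the path  member a s ─ member b (not t) ─ member a (not s) ─ member b t.
    cross : ∀ s t → Walk (member a s) (member b t)
    cross s t with H? (member a s) (member b t)
    ... | no ¬h = step (inj₁ (c-member a s)) (across s t ¬h) (here (inj₂ (c-member b t)))
    ... | yes h =
      step (inj₁ (c-member a s)) (across s (not t) ¬h₁)
        (step (inj₂ (c-member b (not t))) (complement-sym (across (not s) (not t) ¬h₂))
          (step (inj₁ (c-member a (not s))) (across (not s) t ¬h₃)
            (here (inj₂ (c-member b t)))))
      where
      ¬h₁ : ¬ H (member a s) (member b (not t))
      ¬h₁ h′ = members-distinct b t
        (one-edge-between (colours-differ s t ∘ sym) (same-class b t (not t)) refl (H-sym h) (H-sym h′))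
      ¬h₂ : ¬ H (member a (not s)) (member b (not t))
      ¬h₂ h′ = members-distinct a s
        (one-edge-between (colours-differ s t) (same-class a s (not s)) (same-class b t (not t)) h h′)
      ¬h₃ : ¬ H (member a (not s)) (member b t)
      ¬h₃ h′ = members-distinct a s (one-edge-between (colours-differ s t) (same-class a s (not s)) refl h h′)

    walk : ∀ {x y} → c x ≡ a → c y ≡ b → Walk x y
    walk ex ey with covered ex | covered ey
    ... | s , refl | t , refl = cross s t

    connected : InducedConnected Complement P
    connected x y (inj₁ ex) (inj₁ ey) =
      walk ex (c-member b true) ++ʷ walk-reverse complement-sym (walk ey (c-member b true))
    connected x y (inj₁ ex) (inj₂ ey) = walk ex ey
    connected x y (inj₂ ex) (inj₁ ey) = walk-reverse complement-sym (walk ey ex)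
    connected x y (inj₂ ex) (inj₂ ey) =
      walk-reverse complement-sym (walk (c-member a true) ex) ++ʷ walk (c-member a true) ey

  frozen : KempeFrozen Complement k c
  frozen = (λ a → member a true , c-member a true) , (λ a b a≢b → TwoColours.connected a≢b)

module Dq (p : ℕ) where

  q : ℕ
  q = suc (suc p)

  colour : Vtx q → ℕ
  colour = ψℕ q

  two-q : 2 * q ≡ q + q
  two-q = cong (q +_) (+-identityʳ q)

  u′ : ℕ → Vtx q
  u′ n = u (clamp (suc q) n)

  v′ : ℕ → Fin 3 → Vtx q
  v′ k j = v (clamp (suc p) k) j

  toℕ-clamp-v : ∀ {k} → k < q → toℕ (clamp (suc p) k) ≡ k
  toℕ-clamp-v {k} k<q = toℕ-clamp (suc p) k (s≤s⁻¹ k<q)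

  v′-toℕ : ∀ k j → v′ (toℕ k) j ≡ v k j
  v′-toℕ k j = cong (λ k → v k j) (clamp-toℕ (suc p) k)

  uColour : ℕ → ℕ
  uColour zero    = 2 * q
  uColour (suc m) = if suc m ≤ᵇ q then m else q

  uColour-suc-≤ : ∀ {m} → m ≤ q → uColour (suc m) ≡ m
  uColour-suc-≤ {m} m≤q with suc m ≤ᵇ q in eq
  ... | true  = refl
  ... | false = ≤-antisym (≮⇒≥ (λ m<q → subst T eq (≤⇒≤ᵇ m<q))) m≤q

  uColour-suc-≥ : ∀ {m} → q ≤ m → uColour (suc m) ≡ q
  uColour-suc-≥ {m} q≤m with suc m ≤ᵇ q in eq
  ... | true  = contradiction q≤m (<⇒≱ (≤ᵇ⇒≤ (suc m) q (subst T (sym eq) tt)))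
  ... | false = refl

  colour-u : ∀ i → colour (u i) ≡ uColour (toℕ i)
  colour-u 0F     = refl
  colour-u (fs i) = refl

  colour-v₀ : ∀ k → colour (v k 0F) ≡ q + toℕ k
  colour-v₀ 0F     = sym (+-identityʳ q)
  colour-v₀ (fs k) = refl

  colour≤2q : ∀ x → colour x ≤ 2 * q
  colour≤2q (u 0F)     = ≤-refl
  colour≤2q (u (fs i)) = begin
    colour (u (fs i)) ≡⟨ uColour-suc-≤ (s≤s⁻¹ (toℕ<n i)) ⟩
    toℕ i             ≤⟨ s≤s⁻¹ (toℕ<n i) ⟩
    q                 ≤⟨ m≤m+n q _ ⟩
    2 * q             ∎
    where open ≤-Reasoning
  colour≤2q (v k 0F)   = begin
    colour (v k 0F)   ≡⟨ colour-v₀ k ⟩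
    q + toℕ k         ≤⟨ +-monoʳ-≤ q (<⇒≤ (toℕ<n k)) ⟩
    q + q             ≡⟨ two-q ⟨
    2 * q             ∎
    where open ≤-Reasoning
  colour≤2q (v k 1F)   = ≤-trans (<⇒≤ (toℕ<n k)) (m≤m+n q _)
  colour≤2q (v k 2F)   = subst (q + suc (toℕ k) ≤_) (sym two-q) (+-monoʳ-≤ q (toℕ<n k))

  classMember : ℕ → Bool → Vtx q
  classMember n true with n ≤? q
  ... | yes _ = u′ (suc n)
  ... | no  _ = v′ (n ∸ suc q) 2F
  classMember n false with n <? q | n <? q + q
  ... | yes _ | _     = v′ n 1F
  ... | no  _ | yes _ = v′ (n ∸ q) 0F
  ... | no  _ | no  _ = u′ 0

  member-≤q : ∀ {n} → n ≤ q → classMember n true ≡ u′ (suc n)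
  member-≤q {n} n≤q with n ≤? q
  ... | yes _   = refl
  ... | no  n≰q = contradiction n≤q n≰q

  member->q : ∀ k → classMember (q + suc k) true ≡ v′ k 2F
  member->q k with q + suc k ≤? q
  ... | yes n≤q = contradiction n≤q (m+1+n≰m q)
  ... | no  _   = cong (λ m → v′ m 2F) (trans (cong (_∸ suc q) (+-suc q k)) (m+n∸m≡n q k))

  member-<q : ∀ {n} → n < q → classMember n false ≡ v′ n 1F
  member-<q {n} n<q with n <? q
  ... | yes _   = refl
  ... | no  n≮q = contradiction n<q n≮q

  member-q : classMember q false ≡ v′ 0 0F
  member-q with q <? q | q <? q + q
  ... | yes q<q | _       = contradiction q<q (<-irrefl refl)
  ... | no  _   | yes _   = cong (λ m → v′ m 0F) (n∸n≡0 q)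
  ... | no  _   | no  q≮2q = contradiction (m<m+n q z<s) q≮2q

  member-q+suc : ∀ {k} → suc k < q → classMember (q + suc k) false ≡ v′ (suc k) 0F
  member-q+suc {k} k<q with q + suc k <? q | q + suc k <? q + q
  ... | yes lt | _      = contradiction lt (m+n≮m q (suc k))
  ... | no  _  | yes _  = cong (λ m → v′ m 0F) (m+n∸m≡n q (suc k))
  ... | no  _  | no  ge = contradiction (+-monoʳ-< q k<q) ge

  member-2q : classMember (q + q) false ≡ u′ 0
  member-2q with q + q <? q | q + q <? q + q
  ... | yes lt | _      = contradiction lt (m+n≮m q q)
  ... | no  _  | yes lt = contradiction lt (<-irrefl refl)
  ... | no  _  | no  _  = refl

  -- The shapes of the colour classes: {u_{n+1}, v_{n+1,2}} for n < q, {u_{q+1}, v_{11}},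
  -- {v_{k+1,3}, v_{k+2,1}} for q + k + 1 < 2q, and {v_{q3}, u_0}.
  data ColourClass : ℕ → Set where
    low    : ∀ {n} → n < q → ColourClass n
    border : ColourClass q
    mid    : ∀ {k} → suc k < q → ColourClass (q + suc k)
    top    : ColourClass (q + q)

  classify : ∀ {n} → n ≤ 2 * q → ColourClass n
  classify {n} n≤2q with <-cmp n q
  ... | tri< n<q _ _  = low n<q
  ... | tri≈ _ refl _ = border
  ... | tri> _ _ q<n with m≤n⇒∃[o]m+o≡n q<n
  ...   | k , refl with m≤n⇒m<n∨m≡n (+-cancelˡ-≤ q (suc k) q
            (subst (_≤ q + q) (sym (+-suc q k)) (subst (suc q + k ≤_) two-q n≤2q)))
  ...     | inj₁ k<q = subst ColourClass (+-suc q k) (mid k<q)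
  ...     | inj₂ k≡q = subst ColourClass (trans (cong (q +_) (sym k≡q)) (+-suc q k)) top

  colour-u′ : ∀ {n} → n ≤ suc q → colour (u′ n) ≡ uColour n
  colour-u′ {n} n≤ = trans (colour-u (clamp (suc q) n)) (cong uColour (toℕ-clamp (suc q) n n≤))

  colour-member-≤q : ∀ {n} → n ≤ q → colour (classMember n true) ≡ n
  colour-member-≤q {n} n≤q = begin
    colour (classMember n true) ≡⟨ cong colour (member-≤q n≤q) ⟩
    colour (u′ (suc n))         ≡⟨ colour-u′ (s≤s n≤q) ⟩
    uColour (suc n)             ≡⟨ uColour-suc-≤ n≤q ⟩
    n                           ∎
    where open ≡-Reasoning

  colour-member->q : ∀ {k} → k < q → colour (classMember (q + suc k) true) ≡ q + suc k
  colour-member->q {k} k<q = begin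
    colour (classMember (q + suc k) true) ≡⟨ cong colour (member->q k) ⟩
    colour (v′ k 2F)                      ≡⟨ cong (λ m → q + suc m) (toℕ-clamp-v k<q) ⟩
    q + suc k                             ∎
    where open ≡-Reasoning

  colour-member : ∀ {n} → ColourClass n → ∀ s → colour (classMember n s) ≡ n
  colour-member (low n<q)     true  = colour-member-≤q (<⇒≤ n<q)
  colour-member border        true  = colour-member-≤q ≤-refl
  colour-member (mid k<q)     true  = colour-member->q (<-trans (n<1+n _) k<q)
  colour-member top           true  = colour-member->q (n<1+n (suc p))
  colour-member (low n<q)     false = trans (cong colour (member-<q n<q)) (toℕ-clamp-v n<q)
  colour-member border        false = cong colour member-q
  colour-member (mid {k} k<q) false = begin
    colour (classMember (q + suc k) false) ≡⟨ cong colour (member-q+suc k<q) ⟩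
    colour (v′ (suc k) 0F)                 ≡⟨ colour-v₀ _ ⟩
    q + toℕ (clamp (suc p) (suc k))        ≡⟨ cong (q +_) (toℕ-clamp-v k<q) ⟩
    q + suc k                              ∎
    where open ≡-Reasoning
  colour-member top           false = trans (cong colour member-2q) two-q

  member-of-class : ∀ x → ∃ λ s → classMember (colour x) s ≡ x
  member-of-class (u 0F)     = false , trans (cong (λ n → classMember n false) two-q) member-2q
  member-of-class (u (fs i)) = true , (begin
    classMember (colour (u (fs i))) true ≡⟨ cong (λ n → classMember n true) (uColour-suc-≤ i≤q) ⟩
    classMember (toℕ i) true             ≡⟨ member-≤q i≤q ⟩
    u (fs (clamp q (toℕ i)))             ≡⟨ cong (u ∘ fs) (clamp-toℕ q i) ⟩
    u (fs i)                             ∎)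
    where
    open ≡-Reasoning
    i≤q : toℕ i ≤ q
    i≤q = s≤s⁻¹ (toℕ<n i)
  member-of-class (v 0F 0F)     = false , member-q
  member-of-class (v (fs k) 0F) = false , trans (member-q+suc (toℕ<n (fs k))) (v′-toℕ (fs k) 0F)
  member-of-class (v k 1F)      = false , trans (member-<q (toℕ<n k)) (v′-toℕ k 1F)
  member-of-class (v k 2F)      = true , trans (member->q (toℕ k)) (v′-toℕ k 2F)

  pos-v : ∀ k j → pos q (v k j) ≡ suc (suc q) + (3 * toℕ k + toℕ j)
  pos-v k j = +-assoc (suc (suc q)) (3 * toℕ k) (toℕ j)

  pos-v′ : ∀ {k} j → k < q → pos q (v′ k j) ≡ suc (suc q) + (3 * k + toℕ j)
  pos-v′ {k} j k<q = trans (pos-v (clamp (suc p) k) j)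
                            (cong (λ m → suc (suc q) + (3 * m + toℕ j)) (toℕ-clamp-v k<q))

  pos-last : 4 * q + 1 ≡ suc (suc q) + (3 * suc p + 2)
  pos-last = identity p
    where
    identity : ∀ p → 4 * suc (suc p) + 1 ≡ suc (suc (suc (suc p))) + (3 * suc p + 2)
    identity = solve-∀

  members-linked : ∀ {n} → ColourClass n → D̄Arc q (classMember n true) (classMember n false)
  members-linked {n} (low n<q) rewrite member-≤q (<⇒≤ n<q) | member-<q n<q =
    uv _ _ (cong suc (trans (toℕ-clamp q n (<⇒≤ n<q)) (sym (toℕ-clamp-v n<q))))
  members-linked border rewrite member-≤q (≤-refl {q}) | member-q =
    cyc (trans (cong (suc ∘ suc) (trans (toℕ-clamp q q ≤-refl) (sym (+-identityʳ q))))
               (sym (pos-v′ 0F z<s)))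
  members-linked (mid {k} k<q) rewrite member->q k | member-q+suc k<q = cyc (begin
    suc (pos q (v′ k 2F))                  ≡⟨ cong suc (pos-v′ 2F (<-trans (n<1+n k) k<q)) ⟩
    suc (suc (suc q) + (3 * k + 2))        ≡⟨ identity (suc (suc q)) k ⟩
    suc (suc q) + (3 * suc k + 0)          ≡⟨ pos-v′ 0F k<q ⟨
    pos q (v′ (suc k) 0F)                  ∎)
    where
    open ≡-Reasoning
    identity : ∀ m k → suc (m + (3 * k + 2)) ≡ m + (3 * suc k + 0)
    identity = solve-∀
  members-linked top rewrite member->q (suc p) | member-2q =
    close (trans (pos-v′ 2F (n<1+n (suc p))) (sym pos-last)) refl

  members-distinct : ∀ {n} → ColourClass n → classMember n true ≢ classMember n false
  members-distinct (low n<q) rewrite member-≤q (<⇒≤ n<q) | member-<q n<q = λ ()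
  members-distinct border    rewrite member-≤q (≤-refl {q}) | member-q   = λ ()
  members-distinct (mid {k} k<q) rewrite member->q k | member-q+suc k<q = λ ()
  members-distinct top       rewrite member->q (suc p) | member-2q       = λ ()

  data Consecutive : Vtx q → Vtx q → Set where
    u→u   : ∀ {i i′} → suc (toℕ i) ≡ toℕ i′ → Consecutive (u i) (u i′)
    u→v   : ∀ {i} → toℕ i ≡ suc q → Consecutive (u i) (v 0F 0F)
    v₀→v₁ : ∀ k → Consecutive (v k 0F) (v k 1F)
    v₁→v₂ : ∀ k → Consecutive (v k 1F) (v k 2F)
    v₂→v₀ : ∀ {k k′} → suc (toℕ k) ≡ toℕ k′ → Consecutive (v k 2F) (v k′ 0F)

  u-before-v : ∀ i {m} → suc (toℕ i) ≢ suc (suc q) + suc m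
  u-before-v i e = m+1+n≰m (suc (suc q)) (subst (_≤ suc (suc q)) e (toℕ<n i))

  u-then-v : ∀ i k j → suc (toℕ i) ≡ suc (suc q) + (3 * toℕ k + toℕ j) → Consecutive (u i) (v k j)
  u-then-v i 0F 0F     e = u→v (suc-injective (trans e (+-identityʳ _)))
  u-then-v i 0F (fs j) e = contradiction e (u-before-v i)
  u-then-v i (fs k) j  e = contradiction e (u-before-v i)

  v-not-before-u : ∀ k j i → suc (pos q (v k j)) ≢ toℕ i
  v-not-before-u k j i e = <⇒≱ (toℕ<n i) (begin
    suc (suc q)           ≤⟨ m≤m+n _ _ ⟩
    suc (suc q) + (3 * toℕ k + toℕ j) ≡⟨ pos-v k j ⟨
    pos q (v k j)         ≤⟨ n≤1+n _ ⟩
    suc (pos q (v k j))   ≡⟨ e ⟩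
    toℕ i                 ∎)
    where open ≤-Reasoning

  v-then-v : ∀ k j k′ j′ → 3 * toℕ k + suc (toℕ j) ≡ 3 * toℕ k′ + toℕ j′ →
             Consecutive (v k j) (v k′ j′)
  v-then-v k 0F k′ j′ e with divMod-unique 3 (toℕ k) (toℕ k′) (s≤s (s≤s z≤n)) (toℕ<n j′) e
  ... | k≡k′ , 1≡j′ with toℕ-injective {i = k} {j = k′} k≡k′ | toℕ-injective {i = 1F} {j = j′} 1≡j′
  ...   | refl | refl = v₀→v₁ k
  v-then-v k 1F k′ j′ e with divMod-unique 3 (toℕ k) (toℕ k′) (s≤s (s≤s (s≤s z≤n))) (toℕ<n j′) e
  ... | k≡k′ , 2≡j′ with toℕ-injective {i = k} {j = k′} k≡k′ | toℕ-injective {i = 2F} {j = j′} 2≡j′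
  ...   | refl | refl = v₁→v₂ k
  v-then-v k 2F k′ j′ e
    with divMod-unique 3 (suc (toℕ k)) (toℕ k′) z<s (toℕ<n j′) (trans (identity (toℕ k)) e)
    where
    identity : ∀ m → 3 * suc m + 0 ≡ 3 * m + 3
    identity = solve-∀
  ... | k+1≡k′ , 0≡j′ with toℕ-injective {i = 0F} {j = j′} 0≡j′
  ...   | refl = v₂→v₀ k+1≡k′

  consecutive : ∀ x y → suc (pos q x) ≡ pos q y → Consecutive x y
  consecutive (u i)   (u i′)    e = u→u e
  consecutive (u i)   (v k j)   e = u-then-v i k j (trans e (pos-v k j))
  consecutive (v k j) (u i)     e = contradiction e (v-not-before-u k j i)
  consecutive (v k j) (v k′ j′) e = v-then-v k j k′ j′ (+-cancelˡ-≡ (suc (suc q)) _ _ (begin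
    suc (suc q) + (3 * toℕ k + suc (toℕ j)) ≡⟨ +-assoc (suc (suc q)) _ _ ⟨
    suc (suc q) + 3 * toℕ k + suc (toℕ j)   ≡⟨ +-suc _ (toℕ j) ⟩
    suc (pos q (v k j))                     ≡⟨ e ⟩
    pos q (v k′ j′)                         ≡⟨ pos-v k′ j′ ⟩
    suc (suc q) + (3 * toℕ k′ + toℕ j′)     ∎))
    where open ≡-Reasoning

  colour-at-0 : ∀ {y} → pos q y ≡ 0 → colour y ≡ q + q
  colour-at-0 {u 0F}     _ = two-q
  colour-at-0 {u (fs i)} ()
  colour-at-0 {v k j}    ()

  colour-at-last : ∀ {x} → pos q x ≡ 4 * q + 1 → colour x ≡ q + q
  colour-at-last {u i} e = contradiction e (<⇒≢ (<-≤-trans (toℕ<n i)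
    (≤-trans (m≤m+n (suc (suc q)) _) (≤-reflexive (sym pos-last)))))
  colour-at-last {v k j} e
    with divMod-unique 3 (toℕ k) (suc p) (toℕ<n j) (s≤s (s≤s (s≤s z≤n)))
           (+-cancelˡ-≡ (suc (suc q)) _ _ (trans (sym (pos-v k j)) (trans e pos-last)))
  ... | k≡1+p , j≡2 with toℕ-injective {i = j} {j = 2F} j≡2
  ...   | refl = cong (λ m → q + suc m) k≡1+p

  -- Sees x b: b is the colour of a D̄-neighbour of x outside its colour class.  For u_i
  -- these are the colours of u_{i-1} and u_{i+1}; at u_0 and u_{q+1} the boundary values
  -- of uColour add the vertex's own colour, which is harmless.
  SeesU : ℕ → ℕ → Set
  SeesU i b = b ≡ uColour (pred i) ⊎ b ≡ uColour (suc i)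

  SeesV : ℕ → Fin 3 → ℕ → Set
  SeesV k 0F b = b ≡ k     ⊎ b ≡ q + suc k
  SeesV k 1F b = b ≡ q + k ⊎ b ≡ q + suc k
  SeesV k 2F b = b ≡ k     ⊎ b ≡ q + k

  Sees : Vtx q → ℕ → Set
  Sees (u i)   = SeesU (toℕ i)
  Sees (v k j) = SeesV (toℕ k) j

  Across : Vtx q → Vtx q → Set
  Across x y = Sees x (colour y) × Sees y (colour x)

  consecutive-colours : ∀ {x y} → Consecutive x y → colour x ≡ colour y ⊎ Across x y
  consecutive-colours (u→u {i} {i′} e) = inj₂ (inj₂ (trans (colour-u i′) (cong uColour (sym e))) ,
                                               inj₁ (trans (colour-u i) (cong (uColour ∘ pred) e)))
  consecutive-colours (u→v {i} e) =
    inj₁ (trans (colour-u i) (trans (cong uColour e) (uColour-suc-≤ ≤-refl)))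
  consecutive-colours (v₀→v₁ k)   = inj₂ (inj₁ refl , inj₁ (colour-v₀ k))
  consecutive-colours (v₁→v₂ k)   = inj₂ (inj₂ refl , inj₁ refl)
  consecutive-colours (v₂→v₀ {k′ = k′} e) = inj₁ (trans (cong (q +_) e) (sym (colour-v₀ k′)))

  arc-colours : ∀ {x y} → D̄Arc q x y → colour x ≡ colour y ⊎ Across x y
  arc-colours {x} {y} (cyc e)       = consecutive-colours (consecutive x y e)
  arc-colours {x} {y} (close e₁ e₂) = inj₁ (trans (colour-at-last {x} e₁) (sym (colour-at-0 {y} e₂)))
  arc-colours (uv i k e)            =
    inj₁ (trans (colour-u i) (trans (cong uColour e) (uColour-suc-≤ (<⇒≤ (toℕ<n k)))))
  arc-colours (vv k)                = inj₂ (inj₂ refl , inj₂ (colour-v₀ k))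

  sees-across : ∀ {x y} → D̄Adj q x y → colour x ≢ colour y → Sees x (colour y)
  sees-across (inj₁ a) x≢y with arc-colours a
  ... | inj₁ x≡y     = contradiction x≡y x≢y
  ... | inj₂ (s , _) = s
  sees-across (inj₂ a) x≢y with arc-colours a
  ... | inj₁ y≡x     = contradiction (sym y≡x) x≢y
  ... | inj₂ (_ , s) = s

  sees-u′ : ∀ {n b} → n ≤ suc q → Sees (u′ n) b → SeesU n b
  sees-u′ {n} {b} n≤ = subst (λ i → SeesU i b) (toℕ-clamp (suc q) n n≤)

  sees-v′ : ∀ {k} j {b} → k < q → Sees (v′ k j) b → SeesV k j b
  sees-v′ {k} j {b} k<q = subst (λ m → SeesV m j b) (toℕ-clamp-v k<q)

  below-q+ : ∀ {m n} → m ≤ n → m < q + n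
  below-q+ {n = n} m≤n = ≤-<-trans m≤n (m<n+m n z<s)

  low-apart : ∀ {n b} → n < q → SeesU (suc n) b → ¬ SeesV n 1F b
  low-apart {zero}  _   = disjoint-pairs (0≢1+n ∘ sym ∘ +-cancelˡ-≡ q (q + 0) 0)
                                (1+n≢0 ∘ suc-injective ∘ +-cancelˡ-≡ q (q + 0) 1) (λ ()) (λ ())
  low-apart {suc m} m<q = disjoint-pairs (<⇒≢ (below-q+ (n≤1+n m)))
                                (<⇒≢ (below-q+ (≤-trans (n≤1+n m) (n≤1+n _))))
                                (λ e → m≢1+n+m m (trans (suc-injective (suc-injective e)) (+-suc p m)))
                                (<⇒≢ (below-q+ ≤-refl))
                        ∘ map₁ (flip trans (uColour-suc-≤ (≤-trans (n≤1+n m) (<⇒≤ m<q))))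
                        ∘ map₂ (flip trans (uColour-suc-≤ m<q))

  border-apart : ∀ {b} → SeesU (suc q) b → ¬ SeesV 0 0F b
  border-apart = disjoint-pairs (λ ()) (m≢1+m+n p ∘ suc-injective) (λ ()) (<⇒≢ (m<m+n q z<s))
               ∘ map₁ (flip trans (uColour-suc-≤ (n≤1+n (suc p))))
               ∘ map₂ (flip trans (uColour-suc-≥ (n≤1+n q)))

  mid-apart : ∀ {k b} → suc k < q → SeesV k 2F b → ¬ SeesV (suc k) 0F b
  mid-apart {k} _ = disjoint-pairs (<⇒≢ (n<1+n k))
                          (<⇒≢ (below-q+ (≤-trans (n≤1+n k) (n≤1+n _))))
                          (m≢1+n+m k ∘ sym ∘ suc-injective)
                          (<⇒≢ (+-monoʳ-< q (≤-trans (n<1+n k) (n≤1+n (suc k)))))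

  top-apart : ∀ {b} → SeesV (suc p) 2F b → ¬ SeesU 0 b
  top-apart = disjoint-pairs (m≢1+m+n p ∘ suc-injective) (λ ())
                    (m≢1+m+n p ∘ suc-injective ∘ +-cancelˡ-≡ q (suc p) (q + 0)) (λ ())

  members-see-apart : ∀ {n b} → ColourClass n →
                      Sees (classMember n true) b → ¬ Sees (classMember n false) b
  members-see-apart (low n<q) rewrite member-≤q (<⇒≤ n<q) | member-<q n<q = λ s₁ s₂ →
    low-apart n<q (sees-u′ (s≤s (<⇒≤ n<q)) s₁) (sees-v′ 1F n<q s₂)
  members-see-apart border rewrite member-≤q (≤-refl {q}) | member-q = λ s₁ →
    border-apart (sees-u′ ≤-refl s₁)
  members-see-apart (mid {k} k<q) rewrite member->q k | member-q+suc k<q = λ s₁ s₂ →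
    mid-apart k<q (sees-v′ 2F (<-trans (n<1+n k) k<q) s₁) (sees-v′ 0F k<q s₂)
  members-see-apart top rewrite member->q (suc p) | member-2q = λ s₁ →
    top-apart (sees-v′ 2F (n<1+n (suc p)) s₁)

  same-class-sees : ∀ {x x′ b} → colour x ≡ colour x′ → Sees x b → Sees x′ b → x ≡ x′
  same-class-sees {x} {x′} {b} e sx sx′ with member-of-class x | member-of-class x′
  ... | s , ex | s′ , ex′ = by-sides s s′ ex (trans (cong (λ n → classMember n s′) e) ex′)
    where
    class = classify (colour≤2q x)
    by-sides : ∀ s s′ → classMember (colour x) s ≡ x → classMember (colour x) s′ ≡ x′ → x ≡ x′
    by-sides true  true  ex ex′ = trans (sym ex) ex′
    by-sides false false ex ex′ = trans (sym ex) ex′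
    by-sides true  false ex ex′ =
      ⊥-elim (members-see-apart class (subst (flip Sees b) (sym ex) sx) (subst (flip Sees b) (sym ex′) sx′))
    by-sides false true  ex ex′ =
      ⊥-elim (members-see-apart class (subst (flip Sees b) (sym ex′) sx′) (subst (flip Sees b) (sym ex) sx))

  edges-determined-by-colours : ∀ {s t s′ t′} → colour s ≢ colour t →
                                colour s ≡ colour s′ → colour t ≡ colour t′ →
                                D̄Adj q s t → D̄Adj q s′ t′ → s ≡ s′
  edges-determined-by-colours {s′ = s′} s≢t s≡s′ t≡t′ h h′ =
    same-class-sees s≡s′ (sees-across h s≢t)
      (subst (Sees s′) (sym t≡t′) (sees-across h′ (λ e → s≢t (trans s≡s′ (trans e (sym t≡t′))))))

  data Chord : Vtx q → Vtx q → Set where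
    u-v : ∀ {i k} → toℕ i ≡ suc (toℕ k) → Chord (u i) (v k 1F)
    v-v : ∀ {k} → Chord (v k 0F) (v k 2F)

  chord? : ∀ x y → Dec (Chord x y)
  chord? (u i)    (v k 1F)  = map′ u-v (λ { (u-v e) → e }) (toℕ i ≟ suc (toℕ k))
  chord? (v k 0F) (v k′ 2F) = map′ (λ { refl → v-v }) (λ { v-v → refl }) (k ≟ᶠ k′)
  chord? (u _)    (u _)     = no λ ()
  chord? (u _)    (v _ 0F)  = no λ ()
  chord? (u _)    (v _ 2F)  = no λ ()
  chord? (v _ _)  (u _)     = no λ ()
  chord? (v _ 0F) (v _ 0F)  = no λ ()
  chord? (v _ 0F) (v _ 1F)  = no λ ()
  chord? (v _ 1F) (v _ _)   = no λ ()
  chord? (v _ 2F) (v _ _)   = no λ ()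

  ArcKind : Vtx q → Vtx q → Set
  ArcKind x y = suc (pos q x) ≡ pos q y ⊎ (pos q x ≡ 4 * q + 1 × pos q y ≡ 0) ⊎ Chord x y

  arc-kind : ∀ {x y} → D̄Arc q x y → ArcKind x y
  arc-kind (cyc e)       = inj₁ e
  arc-kind (close e₁ e₂) = inj₂ (inj₁ (e₁ , e₂))
  arc-kind (uv _ _ e)    = inj₂ (inj₂ (u-v e))
  arc-kind (vv _)        = inj₂ (inj₂ v-v)

  arc-of-kind : ∀ {x y} → ArcKind x y → D̄Arc q x y
  arc-of-kind (inj₁ e)                = cyc e
  arc-of-kind (inj₂ (inj₁ (e₁ , e₂))) = close e₁ e₂
  arc-of-kind (inj₂ (inj₂ (u-v e)))   = uv _ _ e
  arc-of-kind (inj₂ (inj₂ v-v))       = vv _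

  D̄Adj? : Decidable (D̄Adj q)
  D̄Adj? x y = D̄Arc? x y ⊎-dec D̄Arc? y x
    where
    D̄Arc? : ∀ x y → Dec (D̄Arc q x y)
    D̄Arc? x y = map′ arc-of-kind arc-kind
      (suc (pos q x) ≟ pos q y ⊎-dec (pos q x ≟ 4 * q + 1 ×-dec pos q y ≟ 0) ⊎-dec chord? x y)

  toℕ-ψ : ∀ x → toℕ (ψ q x) ≡ colour x
  toℕ-ψ x = toℕ-clamp (2 * q) (colour x) (colour≤2q x)

  colour-from-ψ : ∀ {x y} → ψ q x ≡ ψ q y → colour x ≡ colour y
  colour-from-ψ {x} {y} e = trans (sym (toℕ-ψ x)) (trans (cong toℕ e) (toℕ-ψ y))

  member : Fin (suc (2 * q)) → Bool → Vtx q
  member a = classMember (toℕ a)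

  member-class : ∀ a → ColourClass (toℕ a)
  member-class a = classify (s≤s⁻¹ (toℕ<n a))

  ψ-member : ∀ a s → ψ q (member a s) ≡ a
  ψ-member a s = trans (cong (clamp (2 * q)) (colour-member (member-class a) s)) (clamp-toℕ (2 * q) a)

  member-cover : ∀ x → ∃ λ s → member (ψ q x) s ≡ x
  member-cover x with member-of-class x
  ... | s , e = s , trans (cong (λ n → classMember n s) (toℕ-ψ x)) e

  member-linked : ∀ a → D̄Adj q (member a true) (member a false)
  member-linked a = inj₁ (members-linked (member-class a))

  member-distinct : ∀ a → member a true ≢ member a false
  member-distinct a = members-distinct (member-class a)

  one-edge-between : ∀ {s t s′ t′} → ψ q s ≢ ψ q t → ψ q s ≡ ψ q s′ → ψ q t ≡ ψ q t′ →
           D̄Adj q s t → D̄Adj q s′ t′ → s ≡ s′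
  one-edge-between {s} {t} {s′} {t′} s≢t s≡s′ t≡t′ =
    edges-determined-by-colours (s≢t ∘ cong (clamp (2 * q)))
      (colour-from-ψ {s} {s′} s≡s′) (colour-from-ψ {t} {t′} t≡t′)

lemma6 : ∀ (q : ℕ) → 2 ≤ q →
    ProperColouring (DAdj q) (suc (2 * q)) (ψ q) × KempeFrozen (DAdj q) (suc (2 * q)) (ψ q)
lemma6 (suc (suc p)) (s≤s (s≤s z≤n)) = Kempe.proper , Kempe.frozen
  where
  open Dq p
  module Kempe = PairedComplement (D̄Adj q) swap D̄Adj? (ψ q) member
                   ψ-member member-cover member-linked member-distinct one-edge-between
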